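{- Let $G$ be a diameter-3-critical graph on $n$ vertices, with critical paths fixed as described in the context, let $t=\sqrt{n^2/\mathrm{RS}(n)}$, and let $G_0$ be the graph obtained from $G$ by deleting (i) all edges of multiplicity at least $t$, and (ii) all edges lying on some $t$-light 2-critical path of $G$. Then every critical pair and every 2-critical pair of $G$ belongs to $\mathrm{Di}(G_0)$.
   Context: All graphs are finite and simple; $d_G(x,y)$ is the shortest-path distance and $N_H(v)$ the neighborhood of $v$ in $H$. $G$ is diameter-3-critical if its diameter is 3 and for every edge $e$, $G-e$ has diameter greater than 3. A vertex pair $\{x,y\}$ and edge $e$ are associated if $d_G(x,y)\le 3$ and $d_{G-e}(x,y)\ge 4$; $\{x,y\}$ is critical if some edge is associated with it. For each critical pair one shortest $(x,y)$-path is arbitrarily selected (its critical path); $\mathcal{P}_1(e)$ is the set of critical paths whose pair is associated with $e$. A pair $\{x,y\}$ is 2-critical if there is a unique $(x,y)$-path of length at most 2 (called a 2-critical path); $\mathcal{P}_2(e)$ is the set of 2-critical paths containing $e$. The multiplicity of $e$ is $m(e)=|\mathcal{P}_1(e)|+|\mathcal{P}_2(e)|$. A 2-critical path is $t$-light if it has length 2 and both its edges have multiplicity less than $t$. $\mathrm{RS}(n)$ is the maximum number of 3-edges in a linear (any two 3-edges share at most one vertex) 3-uniform hypergraph on $n$ vertices containing no three 3-edges of the form $\{\{1,2,3\},\{3,4,5\},\{5,6,1\}\}$. For a graph $H$, $\mathrm{Di}(H)$ is the set of unordered vertex pairs $\{u,v\}$ with $N_H(u)\cap N_H(v)=\emptyset$.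 -}

module Defs where

open import Data.Bool using (Bool; true; false; _∧_; _∨_; not; if_then_else_)
open import Data.Nat using (ℕ; zero; suc; _+_; _*_; _≤_; _≤ᵇ_; _≡ᵇ_)
open import Data.Fin using (Fin; _≟_; _<?_)
open import Data.List using (List; _∷_; []; allFin; map)
open import Data.Bool.ListAction using (any)
open import Data.Nat.ListAction using (sum)
open import Data.List.Relation.Unary.Unique.Propositional using (Unique)
open import Data.Product using (Σ; _×_)
open import Data.Empty using (⊥)
open import Relation.Nullary.Decidable using (⌊_⌋)
open import Relation.Binary.PropositionalEquality using (_≡_)

anyF : ∀ {n} → (Fin n → Bool) → Bool
anyF {n} p = any p (allFin n)

countF : ∀ {n} → (Fin n → Bool) → ℕ
countF {n} p = sum (map (λ x → if p x then 1 else 0) (allFin n))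

eqF : ∀ {n} → Fin n → Fin n → Bool
eqF x y = ⌊ x ≟ y ⌋

ltF : ∀ {n} → Fin n → Fin n → Bool
ltF x y = ⌊ x <? y ⌋

countPairs : ∀ {n} → (Fin n → Fin n → Bool) → ℕ
countPairs {n} p = sum (map (λ x → countF (λ y → ltF x y ∧ p x y)) (allFin n))

record Graph (n : ℕ) : Set where
  field
    adj    : Fin n → Fin n → Bool
    sym    : ∀ x y → adj x y ≡ adj y x
    irrefl : ∀ x → adj x x ≡ false

Adj : ℕ → Set
Adj n = Fin n → Fin n → Bool

-- within A k x y = true  iff  d(x,y) ≤ k in the graph with adjacency A
within : ∀ {n} → Adj n → ℕ → Fin n → Fin n → Bool
within A zero    x y = eqF x y
within A (suc k) x y = within A k x y ∨ anyF (λ z → within A k x z ∧ A z y)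

sameEdge : ∀ {n} → Fin n → Fin n → Fin n → Fin n → Bool
sameEdge u v a b = (eqF u a ∧ eqF v b) ∨ (eqF u b ∧ eqF v a)

deleteEdge : ∀ {n} → Adj n → Fin n → Fin n → Adj n
deleteEdge A u v a b = A a b ∧ not (sameEdge u v a b)

record Diam3Critical {n : ℕ} (G : Graph n) : Set where
  open Graph G
  field
    diamLe3  : ∀ x y → within adj 3 x y ≡ true
    diamGe3  : Σ (Fin n) λ x → Σ (Fin n) λ y → within adj 2 x y ≡ false
    critical : ∀ u v → adj u v ≡ true →
               Σ (Fin n) λ x → Σ (Fin n) λ y → within (deleteEdge adj u v) 3 x y ≡ false

module _ {n : ℕ} (G : Graph n) where
  open Graph G

  associated : Fin n → Fin n → Fin n → Fin n → Bool
  associated x y u v = adj u v ∧ within adj 3 x y ∧ not (within (deleteEdge adj u v) 3 x y)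

  isCritical : Fin n → Fin n → Bool
  isCritical x y = anyF (λ u → anyF (λ v → associated x y u v))

  -- number of (x,y)-paths of length at most 2, for x ≠ y
  nShortPaths : Fin n → Fin n → ℕ
  nShortPaths x y = (if adj x y then 1 else 0) + countF (λ z → adj x z ∧ adj z y)

  is2Critical : Fin n → Fin n → Bool
  is2Critical x y = not (eqF x y) ∧ (nShortPaths x y ≡ᵇ 1)

  twoCritPathContains : Fin n → Fin n → Fin n → Fin n → Bool
  twoCritPathContains x y u v =
    is2Critical x y ∧
    ((adj x y ∧ sameEdge x y u v) ∨
     (not (adj x y) ∧ anyF (λ z → adj x z ∧ adj z y ∧ (sameEdge x z u v ∨ sameEdge z y u v))))

  -- |P1(e)|: one critical path per critical pair associated with e
  size𝒫₁ : Fin n → Fin n → ℕ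
  size𝒫₁ u v = countPairs (λ x y → associated x y u v)

  size𝒫₂ : Fin n → Fin n → ℕ
  size𝒫₂ u v = countPairs (λ x y → twoCritPathContains x y u v)

  multiplicity : Fin n → Fin n → ℕ
  multiplicity u v = size𝒫₁ u v + size𝒫₂ u v

  -- With t = sqrt(n²/r) (r = RS(n)), for m ∈ ℕ:  m ≥ t  ⇔  n² ≤ r·m².
  -- (If r = 0 then t = ∞ and no m satisfies m ≥ t; this is matched for n ≥ 1.)
  heavy : ℕ → Fin n → Fin n → Bool
  heavy r u v = (n * n) ≤ᵇ (r * (multiplicity u v * multiplicity u v))

  light : ℕ → Fin n → Fin n → Bool
  light r u v = not (heavy r u v)

  onLightPath : ℕ → Fin n → Fin n → Bool
  onLightPath r u v =
    anyF (λ x → anyF (λ y →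
      is2Critical x y ∧ not (adj x y) ∧
      anyF (λ z → adj x z ∧ adj z y ∧ light r x z ∧ light r z y ∧
                  (sameEdge x z u v ∨ sameEdge z y u v))))

  adj₀ : ℕ → Adj n
  adj₀ r u v = adj u v ∧ not (heavy r u v) ∧ not (onLightPath r u v)

inDi : ∀ {n} → Adj n → Fin n → Fin n → Bool
inDi A x y = not (anyF (λ z → A x z ∧ A y z))

record Linear3Graph (n : ℕ) : Set where
  field
    edge     : Fin n → Fin n → Fin n → Bool
    sym₁     : ∀ a b c → edge a b c ≡ edge b a c
    sym₂     : ∀ a b c → edge a b c ≡ edge a c b
    distinct : ∀ a c → edge a a c ≡ false
    linear   : ∀ a b c d → (a ≡ b → ⊥) → edge a b c ≡ true → edge a b d ≡ true → c ≡ d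

  size : ℕ
  size = sum (map (λ a → sum (map (λ b → countF (λ c → ltF a b ∧ ltF b c ∧ edge a b c))
                                  (allFin n))) (allFin n))

HasTriangle : ∀ {n} → Linear3Graph n → Set
HasTriangle {n} H =
  Σ (Fin n) λ v1 → Σ (Fin n) λ v2 → Σ (Fin n) λ v3 →
  Σ (Fin n) λ v4 → Σ (Fin n) λ v5 → Σ (Fin n) λ v6 →
    Unique (v1 ∷ v2 ∷ v3 ∷ v4 ∷ v5 ∷ v6 ∷ []) ×
    (edge v1 v2 v3 ≡ true) × (edge v3 v4 v5 ≡ true) × (edge v5 v6 v1 ≡ true)
  where open Linear3Graph H

IsRS : ℕ → ℕ → Set
IsRS n r =
  (Σ (Linear3Graph n) λ H → (HasTriangle H → ⊥) × (Linear3Graph.size H ≡ r)) ×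
  (∀ (H : Linear3Graph n) → (HasTriangle H → ⊥) → Linear3Graph.size H ≤ r)

-- A common neighbour z of x and y in G₀ is impossible. For a 2-critical pair, x z y is its unique
-- short path, so x ≁ y, and both edges survived into G₀, hence are light; but then x z y is a
-- t-light 2-critical path and xz was deleted. A critical pair {x,y}, associated with an edge e,
-- reduces to this: every (x,y)-path of length ≤ 2 must use e (otherwise it survives in G − e),
-- and e lies on at most one such path, so x ≁ y and z is the unique common neighbour.
module Submission where

open import Defs
open import Data.Bool using (Bool; true; false; _∧_; _∨_; not; if_then_else_)
open import Data.Bool.Properties using (∧-comm; ∨-comm; ¬-not; T-≡)
open import Data.Bool.ListAction using (or)
open import Data.Nat using (ℕ; zero; suc; _+_; _*_; _≤_; _≡ᵇ_; _≤ᵇ_; z≤n; s≤s)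
open import Data.Nat.Properties using (≤-trans; m≤n+m)
open import Data.Nat.ListAction using (sum)
open import Data.Fin using (Fin; _≟_) renaming (zero to fzero; suc to fsuc)
open import Data.Fin.Properties using (0≢1+n; suc-injective)
open import Data.List using (map; allFin; tabulate)
open import Data.List.Properties using (map-cong; map-tabulate)
open import Data.List.Relation.Unary.Any using (satisfied)
open import Data.List.Relation.Unary.Any.Properties using (any⁺; any⁻)
open import Data.List.Membership.Propositional using (lose)
open import Data.List.Membership.Propositional.Properties using (∈-allFin)
open import Data.Product using (Σ; _×_; _,_; proj₁; proj₂)
open import Data.Sum using (_⊎_; inj₁; inj₂; [_,_])
open import Data.Empty using (⊥; ⊥-elim)
open import Function.Base using (id)
open import Function.Bundles using (Equivalence)
open import Relation.Nullary using (¬_)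
open import Relation.Nullary.Decidable using (dec-true; dec-false; isYes≗does; toWitness)
open import Relation.Binary.PropositionalEquality
  using (_≡_; refl; sym; trans; cong; cong₂; module ≡-Reasoning)

private
  variable
    n : ℕ

∧-split : ∀ {a b} → a ∧ b ≡ true → a ≡ true × b ≡ true
∧-split {true} b≡true = refl , b≡true

∧-true : ∀ {a b} → a ≡ true → b ≡ true → a ∧ b ≡ true
∧-true refl refl = refl

∨-trueˡ : ∀ {a b} → a ≡ true → a ∨ b ≡ true
∨-trueˡ refl = refl

∨-trueʳ : ∀ {a b} → b ≡ true → a ∨ b ≡ true
∨-trueʳ {true}  _      = refl
∨-trueʳ {false} b≡true = b≡true

not-true : ∀ {a} → not a ≡ true → a ≡ false
not-true {false} _ = refl

true≢false : ∀ {a} → a ≡ true → a ≡ false → ⊥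
true≢false refl ()

eqF-refl : (x : Fin n) → eqF x x ≡ true
eqF-refl x = trans (isYes≗does (x ≟ x)) (dec-true (x ≟ x) refl)

eqF-≢ : {x y : Fin n} → ¬ x ≡ y → eqF x y ≡ false
eqF-≢ {x = x} {y} x≢y = trans (isYes≗does (x ≟ y)) (dec-false (x ≟ y) x≢y)

eqF-sound : {x y : Fin n} → eqF x y ≡ true → x ≡ y
eqF-sound {x = x} {y} e = toWitness {a? = x ≟ y} (Equivalence.from T-≡ e)

anyF-intro : (p : Fin n → Bool) (w : Fin n) → p w ≡ true → anyF p ≡ true
anyF-intro p w pw =
  Equivalence.to T-≡ (any⁺ p (lose (∈-allFin w) (Equivalence.from T-≡ pw)))

anyF-elim : (p : Fin n → Bool) → anyF p ≡ true → Σ (Fin n) λ w → p w ≡ true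
anyF-elim {n} p h with satisfied (any⁻ p (allFin n) (Equivalence.from T-≡ h))
... | w , pw = w , Equivalence.to T-≡ pw

anyF-cong : {p q : Fin n → Bool} → (∀ w → p w ≡ q w) → anyF p ≡ anyF q
anyF-cong {n} p≗q = cong or (map-cong p≗q (allFin n))

indicator : Bool → ℕ
indicator b = if b then 1 else 0

countF-cong : {p q : Fin n → Bool} → (∀ w → p w ≡ q w) → countF p ≡ countF q
countF-cong {n} p≗q = cong sum (map-cong (λ w → cong indicator (p≗q w)) (allFin n))

countPairs-cong : {p q : Fin n → Fin n → Bool} → (∀ x y → p x y ≡ q x y) →
                  countPairs p ≡ countPairs q
countPairs-cong {n} p≗q =
  cong sum (map-cong (λ x → countF-cong (λ y → cong (ltF x y ∧_) (p≗q x y))) (allFin n))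

countF-suc : (p : Fin (suc n) → Bool) →
             countF p ≡ indicator (p fzero) + countF (λ w → p (fsuc w))
countF-suc {n} p = cong (indicator (p fzero) +_) (cong sum (begin
  map (λ w → indicator (p w)) (tabulate fsuc)
    ≡⟨ map-tabulate fsuc (λ w → indicator (p w)) ⟩
  tabulate (λ w → indicator (p (fsuc w)))
    ≡⟨ map-tabulate id (λ w → indicator (p (fsuc w))) ⟨
  map (λ w → indicator (p (fsuc w))) (allFin n)
    ∎))
  where open ≡-Reasoning

countF-pos : (p : Fin n → Bool) (z : Fin n) → p z ≡ true → 1 ≤ countF p
countF-pos p fzero pz rewrite countF-suc p | pz = s≤s z≤n
countF-pos p (fsuc z) pz rewrite countF-suc p =
  ≤-trans (countF-pos (λ w → p (fsuc w)) z pz) (m≤n+m _ (indicator (p fzero)))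

countF-none : (p : Fin n → Bool) → (∀ w → p w ≡ false) → countF p ≡ 0
countF-none {zero}  p none = refl
countF-none {suc n} p none rewrite countF-suc p | none fzero =
  countF-none (λ w → p (fsuc w)) (λ w → none (fsuc w))

countF-single : (p : Fin n → Bool) (z : Fin n) → p z ≡ true →
                (∀ w → p w ≡ true → w ≡ z) → countF p ≡ 1
countF-single p fzero pz only rewrite countF-suc p | pz =
  cong suc (countF-none (λ w → p (fsuc w))
                        (λ w → ¬-not (λ pw → 0≢1+n (sym (only (fsuc w) pw)))))
countF-single p (fsuc z) pz only
  rewrite countF-suc p | ¬-not {p fzero} (λ p0 → 0≢1+n (only fzero p0)) =
  countF-single (λ w → p (fsuc w)) z pz (λ w pw → suc-injective (only (fsuc w) pw))

suc-≡ᵇ-1 : ∀ {c} → 1 ≤ c → (suc c ≡ᵇ 1) ≡ false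
suc-≡ᵇ-1 (s≤s z≤n) = refl

within-cong : {A B : Adj n} → (∀ a b → A a b ≡ B a b) →
              ∀ k x y → within A k x y ≡ within B k x y
within-cong A≗B zero    x y = refl
within-cong A≗B (suc k) x y =
  cong₂ _∨_ (within-cong A≗B k x y)
            (anyF-cong (λ z → cong₂ _∧_ (within-cong A≗B k x z) (A≗B z y)))

within-step : (A : Adj n) (k : ℕ) (x w y : Fin n) →
              within A k x w ≡ true → A w y ≡ true → within A (suc k) x y ≡ true
within-step A k x w y d e =
  ∨-trueʳ {within A k x y} (anyF-intro (λ z → within A k x z ∧ A z y) w (∧-true d e))

within-refl : (A : Adj n) (k : ℕ) (x : Fin n) → within A k x x ≡ true
within-refl A zero    x = eqF-refl x
within-refl A (suc k) x = ∨-trueˡ (within-refl A k x)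

within-edge : (A : Adj n) (k : ℕ) (x y : Fin n) → A x y ≡ true → within A (suc k) x y ≡ true
within-edge A k x y = within-step A k x x y (within-refl A k x)

within-twoPath : (A : Adj n) (k : ℕ) (x w y : Fin n) →
                 A x w ≡ true → A w y ≡ true → within A (suc (suc k)) x y ≡ true
within-twoPath A k x w y xw = within-step A (suc k) x w y (within-edge A k x w xw)

sameEdge-swapˡ : (u v a b : Fin n) → sameEdge v u a b ≡ sameEdge u v a b
sameEdge-swapˡ u v a b = begin
  (eqF v a ∧ eqF u b) ∨ (eqF v b ∧ eqF u a)
    ≡⟨ cong₂ _∨_ (∧-comm (eqF v a) _) (∧-comm (eqF v b) _) ⟩
  (eqF u b ∧ eqF v a) ∨ (eqF u a ∧ eqF v b)
    ≡⟨ ∨-comm (eqF u b ∧ eqF v a) _ ⟩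
  (eqF u a ∧ eqF v b) ∨ (eqF u b ∧ eqF v a)
    ∎
  where open ≡-Reasoning

sameEdge-swapʳ : (u v a b : Fin n) → sameEdge u v b a ≡ sameEdge u v a b
sameEdge-swapʳ u v a b = ∨-comm (eqF u b ∧ eqF v a) _

SamePair : Fin n → Fin n → Fin n → Fin n → Set
SamePair a b c d = (a ≡ c × b ≡ d) ⊎ (a ≡ d × b ≡ c)

sameEdge-sound : (u v a b : Fin n) → sameEdge u v a b ≡ true → SamePair u v a b
sameEdge-sound u v a b h with eqF u a ∧ eqF v b in eq
... | true  = let (ua , vb) = ∧-split eq in inj₁ (eqF-sound ua , eqF-sound vb)
... | false = let (ub , va) = ∧-split h in inj₂ (eqF-sound ub , eqF-sound va)

samePair-trans : {u v a b c d : Fin n} → SamePair u v a b → SamePair u v c d → SamePair a b c d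
samePair-trans (inj₁ (refl , refl)) (inj₁ (refl , refl)) = inj₁ (refl , refl)
samePair-trans (inj₁ (refl , refl)) (inj₂ (refl , refl)) = inj₂ (refl , refl)
samePair-trans (inj₂ (refl , refl)) (inj₁ (refl , refl)) = inj₂ (refl , refl)
samePair-trans (inj₂ (refl , refl)) (inj₂ (refl , refl)) = inj₁ (refl , refl)

OnTwoPath : Fin n → Fin n → Fin n → Fin n → Fin n → Set
OnTwoPath u v x w y = SamePair u v x w ⊎ SamePair u v w y

module _ {u v x y z : Fin n} (x≢y : ¬ x ≡ y) (x≢z : ¬ x ≡ z) (z≢y : ¬ z ≡ y) where

  onTwoPath-unique : ∀ {w} → OnTwoPath u v x w y → OnTwoPath u v x z y → w ≡ z
  onTwoPath-unique (inj₁ s) (inj₁ t) with samePair-trans s t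
  ... | inj₁ (_ , w≡z) = w≡z
  ... | inj₂ (x≡z , _) = ⊥-elim (x≢z x≡z)
  onTwoPath-unique (inj₁ s) (inj₂ t) with samePair-trans s t
  ... | inj₁ (x≡z , _) = ⊥-elim (x≢z x≡z)
  ... | inj₂ (x≡y , _) = ⊥-elim (x≢y x≡y)
  onTwoPath-unique (inj₂ s) (inj₁ t) with samePair-trans s t
  ... | inj₁ (_ , y≡z) = ⊥-elim (z≢y (sym y≡z))
  ... | inj₂ (w≡z , _) = w≡z
  onTwoPath-unique (inj₂ s) (inj₂ t) with samePair-trans s t
  ... | inj₁ (w≡z , _) = w≡z
  ... | inj₂ (_ , y≡z) = ⊥-elim (z≢y (sym y≡z))

  onTwoPath-not-chord : SamePair u v x y → ¬ OnTwoPath u v x z y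
  onTwoPath-not-chord s (inj₁ t) with samePair-trans s t
  ... | inj₁ (_ , y≡z) = z≢y (sym y≡z)
  ... | inj₂ (x≡z , _) = x≢z x≡z
  onTwoPath-not-chord s (inj₂ t) with samePair-trans s t
  ... | inj₁ (x≡z , _) = x≢z x≡z
  ... | inj₂ (x≡y , _) = x≢y x≡y

module _ (G : Graph n) where
  open Graph G renaming (sym to adj-sym)

  adj⇒≢ : ∀ {a b} → adj a b ≡ true → ¬ a ≡ b
  adj⇒≢ {a} ab refl = true≢false ab (irrefl a)

  deleteEdge-swap : ∀ u v a b → deleteEdge adj v u a b ≡ deleteEdge adj u v a b
  deleteEdge-swap u v a b = cong (λ s → adj a b ∧ not s) (sameEdge-swapˡ u v a b)

  associated-swap : ∀ x y u v → associated G x y v u ≡ associated G x y u v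
  associated-swap x y u v =
    cong₂ _∧_ (adj-sym v u)
      (cong (λ d → within adj 3 x y ∧ not d) (within-cong (deleteEdge-swap u v) 3 x y))

  twoCritPathContains-swap : ∀ x y u v →
                             twoCritPathContains G x y v u ≡ twoCritPathContains G x y u v
  twoCritPathContains-swap x y u v = cong (is2Critical G x y ∧_)
    (cong₂ _∨_ (cong (adj x y ∧_) (sameEdge-swapʳ x y u v))
      (cong (not (adj x y) ∧_) (anyF-cong (λ z → cong (λ s → adj x z ∧ adj z y ∧ s)
        (cong₂ _∨_ (sameEdge-swapʳ x z u v) (sameEdge-swapʳ z y u v))))))

  multiplicity-swap : ∀ u v → multiplicity G v u ≡ multiplicity G u v
  multiplicity-swap u v =
    cong₂ _+_ (countPairs-cong (λ x y → associated-swap x y u v))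
              (countPairs-cong (λ x y → twoCritPathContains-swap x y u v))

  light-swap : ∀ r u v → light G r v u ≡ light G r u v
  light-swap r u v = cong (λ m → not (n * n ≤ᵇ r * (m * m))) (multiplicity-swap u v)

  commonNeighbour : Fin n → Fin n → Fin n → Bool
  commonNeighbour x y w = adj x w ∧ adj w y

  x≢midpoint : ∀ {x y z} → commonNeighbour x y z ≡ true → ¬ x ≡ z
  x≢midpoint xzy = adj⇒≢ (proj₁ (∧-split xzy))

  midpoint≢y : ∀ {x y z} → commonNeighbour x y z ≡ true → ¬ z ≡ y
  midpoint≢y {x} {y} {z} xzy = adj⇒≢ (proj₂ (∧-split {adj x z} xzy))

  is2Critical-intro : ∀ {x y z} → ¬ x ≡ y → adj x y ≡ false → commonNeighbour x y z ≡ true →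
                      (∀ w → commonNeighbour x y w ≡ true → w ≡ z) → is2Critical G x y ≡ true
  is2Critical-intro {x} {y} {z} x≢y x≁y xzy unique =
    ∧-true (cong not (eqF-≢ x≢y)) (cong (_≡ᵇ 1) one-short-path)
    where
      one-short-path : nShortPaths G x y ≡ 1
      one-short-path rewrite x≁y = countF-single (commonNeighbour x y) z xzy unique

  is2Critical⇒nonadjacent : ∀ {x y z} → is2Critical G x y ≡ true → commonNeighbour x y z ≡ true →
                            adj x y ≡ false
  -- Matching on `adj x y` also rewrites it inside is2, where nShortPaths becomes 1 + (≥ 1).
  is2Critical⇒nonadjacent {x} {y} {z} is2 xzy with adj x y
  ... | false = refl
  ... | true = ⊥-elim (true≢false (proj₂ (∧-split {not (eqF x y)} is2))
                                 (suc-≡ᵇ-1 (countF-pos (commonNeighbour x y) z xzy)))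

  module _ {x y u v : Fin n} (assoc : associated G x y u v ≡ true) where
    private
      D : Adj n
      D = deleteEdge adj u v

      far : within D 3 x y ≡ false
      far = not-true (proj₂ (∧-split {within adj 3 x y} (proj₂ (∧-split {adj u v} assoc))))

      deleted-or-kept : ∀ {a b} → adj a b ≡ true → SamePair u v a b ⊎ D a b ≡ true
      deleted-or-kept {a} {b} ab with sameEdge u v a b in uv=ab
      ... | true  = inj₁ (sameEdge-sound u v a b uv=ab)
      ... | false = inj₂ (∧-true ab refl)

    associated⇒≢ : ¬ x ≡ y
    associated⇒≢ refl = true≢false (within-refl D 3 x) far

    associated⇒onTwoPath : ∀ {w} → commonNeighbour x y w ≡ true → OnTwoPath u v x w y
    associated⇒onTwoPath {w} xwy with deleted-or-kept (proj₁ (∧-split xwy))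
                                   | deleted-or-kept (proj₂ (∧-split {adj x w} xwy))
    ... | inj₁ uv=xw | _           = inj₁ uv=xw
    ... | inj₂ _     | inj₁ uv=wy  = inj₂ uv=wy
    ... | inj₂ xw    | inj₂ wy     =
      ⊥-elim (true≢false (within-twoPath D 1 x w y xw wy) far)

    associated⇒nonadjacent : ∀ {z} → commonNeighbour x y z ≡ true → adj x y ≡ false
    associated⇒nonadjacent xzy with adj x y in x~y
    ... | false = refl
    ... | true with deleted-or-kept x~y
    ...   | inj₁ uv=xy =
      ⊥-elim (onTwoPath-not-chord associated⇒≢ (x≢midpoint xzy) (midpoint≢y xzy)
                                   uv=xy (associated⇒onTwoPath xzy))
    ...   | inj₂ xy    =
      ⊥-elim (true≢false (within-edge D 2 x y xy) far)

    associated⇒2Critical : ∀ {z} → commonNeighbour x y z ≡ true → is2Critical G x y ≡ true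
    associated⇒2Critical xzy =
      is2Critical-intro associated⇒≢ (associated⇒nonadjacent xzy) xzy λ w xwy →
        onTwoPath-unique associated⇒≢ (x≢midpoint xzy) (midpoint≢y xzy)
                         (associated⇒onTwoPath xwy) (associated⇒onTwoPath xzy)

  critical⇒2Critical : ∀ {x y z} → isCritical G x y ≡ true → commonNeighbour x y z ≡ true →
                       is2Critical G x y ≡ true
  critical⇒2Critical {x} {y} crit xzy
    with anyF-elim (λ u → anyF (λ v → associated G x y u v)) crit
  ... | u , assoc-u with anyF-elim (associated G x y u) assoc-u
  ... | v , assoc = associated⇒2Critical {x} {y} {u} {v} assoc xzy

  lightTwoPath⇒onLightPath : ∀ r {x y z} → is2Critical G x y ≡ true → adj x y ≡ false →
                             adj x z ≡ true → adj z y ≡ true →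
                             light G r x z ≡ true → light G r z y ≡ true →
                             onLightPath G r x z ≡ true
  lightTwoPath⇒onLightPath r {x} {y} {z} is2 x≁y xz zy xz-light zy-light =
    anyF-intro _ x (anyF-intro _ y (∧-true is2 (∧-true (cong not x≁y) (anyF-intro _ z
      (∧-true xz (∧-true zy (∧-true xz-light (∧-true zy-light xz-on-path))))))))
    where
      xz-on-path : (sameEdge x z x z ∨ sameEdge z y x z) ≡ true
      xz-on-path = ∨-trueˡ (∨-trueˡ (∧-true (eqF-refl x) (eqF-refl z)))

  adj₀-split : ∀ r {a b} → adj₀ G r a b ≡ true →
               adj a b ≡ true × light G r a b ≡ true × onLightPath G r a b ≡ false
  adj₀-split r {a} {b} ab₀ with ∧-split ab₀
  ... | ab , rest with ∧-split {light G r a b} rest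
  ... | ab-light , ab-off = ab , ab-light , not-true ab-off

  G₀-noCommonNeighbour : ∀ r {x y z} → isCritical G x y ≡ true ⊎ is2Critical G x y ≡ true →
                         adj₀ G r x z ≡ true → adj₀ G r y z ≡ true → ⊥
  G₀-noCommonNeighbour r {x} {y} {z} pair xz₀ yz₀ =
    let (xz , xz-light , xz-off) = adj₀-split r xz₀
        (yz , yz-light , _)      = adj₀-split r yz₀
        zy       = trans (adj-sym z y) yz
        zy-light = trans (light-swap r y z) yz-light
        xzy      = ∧-true {adj x z} xz zy
        is2      = [ (λ crit → critical⇒2Critical crit xzy) , id ] pair
    in true≢false (lightTwoPath⇒onLightPath r is2 (is2Critical⇒nonadjacent is2 xzy)
                                            xz zy xz-light zy-light) xz-off

-- Neither diameter-criticality nor the value r = RS(n) is needed: the claim holds for every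
-- graph and every threshold.
lemma6p6 : ∀ {n : ℕ} (G : Graph n) → Diam3Critical G →
           ∀ (r : ℕ) → IsRS n r →
           ∀ (x y : Fin n) →
           (isCritical G x y ≡ true ⊎ is2Critical G x y ≡ true) →
           inDi (adj₀ G r) x y ≡ true
lemma6p6 G _ r _ x y pair = cong not (¬-not no-common-neighbour)
  where
    common₀ : Fin _ → Bool
    common₀ z = adj₀ G r x z ∧ adj₀ G r y z

    no-common-neighbour : ¬ anyF common₀ ≡ true
    no-common-neighbour common =
      let (_ , xz∧yz) = anyF-elim common₀ common
          (xz₀ , yz₀) = ∧-split {adj₀ G r x _} xz∧yz
      in G₀-noCommonNeighbour G r pair xz₀ yz₀
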